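{- For all positive integers $a$ and $n$, a $\mathrm{LC}(a^n)$ exists, i.e. there is a latin cube of order $an$ with $n$ pairwise disjoint subcubes each of order $a$.
   Context: A latin cube of order $N$ is an $N\times N\times N$ array on $N$ symbols such that any two cells whose coordinates differ in exactly one position contain different symbols; a subcube is an $m\times m\times m$ subarray (indices in each coordinate from chosen $m$-sets) that is itself a latin cube of order $m$; subcubes are disjoint if they share no index in any coordinate and no symbol. $\mathrm{LC}(a^n)$ denotes a latin cube of order $an$ with $n$ pairwise disjoint subcubes of order $a$. -}

module Defs where

open import Data.Nat using (ℕ; _*_)
open import Data.Fin using (Fin)
open import Data.Product using (Σ; _×_)
open import Relation.Binary.PropositionalEquality using (_≡_)
open import Relation.Nullary using (¬_)
open import Function.Definitions using (Injective)

Cube : ℕ → Set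
Cube N = Fin N → Fin N → Fin N → Fin N

IsLatin : ∀ {N} → Cube N → Set
IsLatin {N} L =
  (∀ y z → Injective _≡_ _≡_ (λ x → L x y z)) ×
  (∀ x z → Injective _≡_ _≡_ (λ y → L x y z)) ×
  (∀ x y → Injective _≡_ _≡_ (λ z → L x y z))

-- A subcube of order m of L: chosen m-sets of indices in each coordinate
-- (injective maps r, c, s : Fin m → Fin N), an m-set of symbols (injective
-- σ : Fin m → Fin N), such that the subarray is a latin cube of order m on
-- those symbols: L (r i) (c j) (s k) = σ (M i j k) with M latin.
record Subcube {N : ℕ} (L : Cube N) (m : ℕ) : Set where
  field
    r c s σ : Fin m → Fin N
    r-inj : Injective _≡_ _≡_ r
    c-inj : Injective _≡_ _≡_ c
    s-inj : Injective _≡_ _≡_ s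
    σ-inj : Injective _≡_ _≡_ σ
    M     : Cube m
    M-latin : IsLatin M
    entries : ∀ i j k → L (r i) (c j) (s k) ≡ σ (M i j k)

DisjointImages : ∀ {m N : ℕ} → (Fin m → Fin N) → (Fin m → Fin N) → Set
DisjointImages f g = ∀ i j → ¬ (f i ≡ g j)

Disjoint : ∀ {N m} {L : Cube N} → Subcube L m → Subcube L m → Set
Disjoint A B =
  DisjointImages (Subcube.r A) (Subcube.r B) ×
  DisjointImages (Subcube.c A) (Subcube.c B) ×
  DisjointImages (Subcube.s A) (Subcube.s B) ×
  DisjointImages (Subcube.σ A) (Subcube.σ B)

LC : ℕ → ℕ → Set
LC a n =
  Σ (Cube (a * n)) λ L →
    IsLatin L ×
    Σ (Fin n → Subcube L a) λ S →
      ∀ p q → ¬ (p ≡ q) → Disjoint (S p) (S q)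

-- Take the direct product of a latin cube A of order a with the cyclic latin
-- cube B u v w = u − v + w − 1 (mod n), identifying Fin a × Fin n with
-- Fin (a·n) via combine.  For each p : Fin n the cells whose three Fin n
-- components all equal p form a copy of A, whose symbols have second component
-- B p p p = p − 1.  Since p ↦ p − 1 is injective, copies for different p share
-- neither indices nor symbols.
module Submission where

open import Defs
open import Data.Nat using (ℕ; _≥_; _≤_; suc; _+_; _∸_; _*_; NonZero; >-nonZero)
open import Data.Nat.Properties using (+-comm; +-assoc; m+[n∸m]≡n; suc-injective; <⇒≤)
open import Data.Nat.DivMod using (_%_; _mod_; %-distribˡ-+; m%n%n≡m%n; [m+n]%n≡m%n; m<n⇒m%n≡m)
open import Data.Fin using (Fin; toℕ; combine; remQuot; opposite)
open import Data.Fin.Properties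
  using (toℕ-injective; toℕ<n; toℕ-fromℕ<; opposite-prop; opposite-involutive;
         combine-remQuot; remQuot-combine; combine-injectiveˡ; combine-injectiveʳ)
open import Data.Product using (_,_; proj₁; proj₂; uncurry)
open import Data.Product.Properties using (×-≡,≡→≡)
open import Function.Definitions using (Injective)
open import Function.Nary.NonDependent using (congₙ)
open import Relation.Binary.PropositionalEquality
open ≡-Reasoning

[[m+n]%d+[d∸m]]%d≡n%d : ∀ m n d .{{_ : NonZero d}} → m ≤ d →
                         ((m + n) % d + (d ∸ m)) % d ≡ n % d
[[m+n]%d+[d∸m]]%d≡n%d m n d m≤d = begin
  ((m + n) % d + (d ∸ m)) % d         ≡⟨ %-distribˡ-+ ((m + n) % d) (d ∸ m) d ⟩
  ((m + n) % d % d + (d ∸ m) % d) % d ≡⟨ cong (λ t → (t + (d ∸ m) % d) % d) (m%n%n≡m%n (m + n) d) ⟩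
  ((m + n) % d + (d ∸ m) % d) % d     ≡⟨ %-distribˡ-+ (m + n) (d ∸ m) d ⟨
  (m + n + (d ∸ m)) % d               ≡⟨ cong (_% d) m+n+[d∸m]≡n+d ⟩
  (n + d) % d                         ≡⟨ [m+n]%n≡m%n n d ⟩
  n % d                               ∎
  where
  m+n+[d∸m]≡n+d : m + n + (d ∸ m) ≡ n + d
  m+n+[d∸m]≡n+d = begin
    m + n + (d ∸ m)   ≡⟨ cong (_+ (d ∸ m)) (+-comm m n) ⟩
    n + m + (d ∸ m)   ≡⟨ +-assoc n m (d ∸ m) ⟩
    n + (m + (d ∸ m)) ≡⟨ cong (n +_) (m+[n∸m]≡n m≤d) ⟩
    n + d             ∎

opposite-injective : ∀ {n} → Injective _≡_ _≡_ (opposite {n})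
opposite-injective {x = i} {j} eq = begin
  i                     ≡⟨ opposite-involutive i ⟨
  opposite (opposite i) ≡⟨ cong opposite eq ⟩
  opposite (opposite j) ≡⟨ opposite-involutive j ⟩
  j                     ∎

suc[toℕ+toℕ-opposite]≡n : ∀ {n} (i : Fin n) → suc (toℕ i + toℕ (opposite i)) ≡ n
suc[toℕ+toℕ-opposite]≡n {n} i = begin
  suc (toℕ i) + toℕ (opposite i)  ≡⟨ cong (suc (toℕ i) +_) (opposite-prop i) ⟩
  suc (toℕ i) + (n ∸ suc (toℕ i)) ≡⟨ m+[n∸m]≡n (toℕ<n i) ⟩
  n                               ∎

module Cyclic {n : ℕ} .{{_ : NonZero n}} where

  infixl 6 _⊕_

  _⊕_ : Fin n → Fin n → Fin n
  i ⊕ j = (toℕ i + toℕ j) mod n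

  ⊕-comm : ∀ i j → i ⊕ j ≡ j ⊕ i
  ⊕-comm i j = cong (_mod n) (+-comm (toℕ i) (toℕ j))

  ⊕-cancelˡ : ∀ i → Injective _≡_ _≡_ (i ⊕_)
  ⊕-cancelˡ i {j} {k} eq = toℕ-injective (begin
    toℕ j                           ≡⟨ unshift j ⟨
    (toℕ (i ⊕ j) + (n ∸ toℕ i)) % n ≡⟨ cong (λ t → (toℕ t + (n ∸ toℕ i)) % n) eq ⟩
    (toℕ (i ⊕ k) + (n ∸ toℕ i)) % n ≡⟨ unshift k ⟩
    toℕ k                           ∎)
    where
    unshift : ∀ x → (toℕ (i ⊕ x) + (n ∸ toℕ i)) % n ≡ toℕ x
    unshift x = begin
      (toℕ (i ⊕ x) + (n ∸ toℕ i)) % n        ≡⟨ cong (λ t → (t + (n ∸ toℕ i)) % n) (toℕ-fromℕ< _) ⟩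
      ((toℕ i + toℕ x) % n + (n ∸ toℕ i)) % n ≡⟨ [[m+n]%d+[d∸m]]%d≡n%d (toℕ i) (toℕ x) n (<⇒≤ (toℕ<n i)) ⟩
      toℕ x % n                              ≡⟨ m<n⇒m%n≡m (toℕ<n x) ⟩
      toℕ x                                  ∎

  ⊕-cancelʳ : ∀ j → Injective _≡_ _≡_ (_⊕ j)
  ⊕-cancelʳ j {i} {i′} eq = ⊕-cancelˡ j (trans (⊕-comm j i) (trans eq (⊕-comm i′ j)))

  ⊕-opposite-const : ∀ i j → i ⊕ opposite i ≡ j ⊕ opposite j
  ⊕-opposite-const i j = cong (_mod n) (suc-injective
    (trans (suc[toℕ+toℕ-opposite]≡n i) (sym (suc[toℕ+toℕ-opposite]≡n j))))

  -- opposite v = −1 − v (mod n), so this is u − v + w − 1.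
  cyclicCube : Cube n
  cyclicCube u v w = u ⊕ opposite v ⊕ w

  cyclicCube-latin : IsLatin cyclicCube
  cyclicCube-latin =
      (λ v w eq → ⊕-cancelʳ _ (⊕-cancelʳ w eq))
    , (λ u w eq → opposite-injective (⊕-cancelˡ u (⊕-cancelʳ w eq)))
    , (λ u v eq → ⊕-cancelˡ _ eq)

  cyclicCube-diagonal-injective : Injective _≡_ _≡_ (λ p → cyclicCube p p p)
  cyclicCube-diagonal-injective {p} {q} eq =
    ⊕-cancelˡ (p ⊕ opposite p) (trans eq (cong (_⊕ q) (⊕-opposite-const q p)))

module Product {a n : ℕ} where

  block : Fin (a * n) → Fin a
  block x = proj₁ (remQuot {a} n x)

  offset : Fin (a * n) → Fin n
  offset x = proj₂ (remQuot {a} n x)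

  block-combine : ∀ (i : Fin a) (u : Fin n) → block (combine i u) ≡ i
  block-combine i u = cong proj₁ (remQuot-combine i u)

  offset-combine : ∀ (i : Fin a) (u : Fin n) → offset (combine i u) ≡ u
  offset-combine i u = cong proj₂ (remQuot-combine i u)

  combine-injectiveˡ′ : ∀ {i j : Fin a} {u v : Fin n} → combine i u ≡ combine j v → i ≡ j
  combine-injectiveˡ′ {i} {j} {u} {v} = combine-injectiveˡ i u j v

  combine-injectiveʳ′ : ∀ {i j : Fin a} {u v : Fin n} → combine i u ≡ combine j v → u ≡ v
  combine-injectiveʳ′ {i} {j} {u} {v} = combine-injectiveʳ i u j v

  combine-injective-on-parts : {f : Fin a → Fin a} {g : Fin n → Fin n} →
    Injective _≡_ _≡_ f → Injective _≡_ _≡_ g →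
    Injective _≡_ _≡_ (λ x → combine (f (block x)) (g (offset x)))
  combine-injective-on-parts {f} {g} f-inj g-inj {x} {x′} eq = begin
    x                                  ≡⟨ combine-remQuot {a} n x ⟨
    uncurry combine (remQuot {a} n x)  ≡⟨ cong (uncurry combine) (×-≡,≡→≡ (same-block , same-offset)) ⟩
    uncurry combine (remQuot {a} n x′) ≡⟨ combine-remQuot {a} n x′ ⟩
    x′                                 ∎
    where
    same-block  = f-inj (combine-injectiveˡ′ eq)
    same-offset = g-inj (combine-injectiveʳ′ eq)

  infixl 7 _⊗_

  _⊗_ : Cube a → Cube n → Cube (a * n)
  (A ⊗ B) x y z = combine (A (block x) (block y) (block z)) (B (offset x) (offset y) (offset z))

  ⊗-latin : {A : Cube a} {B : Cube n} → IsLatin A → IsLatin B → IsLatin (A ⊗ B)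
  ⊗-latin (A₁ , A₂ , A₃) (B₁ , B₂ , B₃) =
      (λ y z → combine-injective-on-parts (A₁ (block y) (block z)) (B₁ (offset y) (offset z)))
    , (λ x z → combine-injective-on-parts (A₂ (block x) (block z)) (B₂ (offset x) (offset z)))
    , (λ x y → combine-injective-on-parts (A₃ (block x) (block y)) (B₃ (offset x) (offset y)))

  ⊗-combine : (A : Cube a) (B : Cube n) (i j k : Fin a) (u v w : Fin n) →
    (A ⊗ B) (combine i u) (combine j v) (combine k w) ≡ combine (A i j k) (B u v w)
  ⊗-combine A B i j k u v w = cong₂ combine
    (congₙ 3 A (block-combine i u) (block-combine j v) (block-combine k w))
    (congₙ 3 B (offset-combine i u) (offset-combine j v) (offset-combine k w))

  fibreSubcube : {A : Cube a} (B : Cube n) → IsLatin A → Fin n → Subcube (A ⊗ B) a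
  fibreSubcube {A} B A-latin p = record
    { r = (λ i → combine i p) ; c = (λ i → combine i p) ; s = (λ i → combine i p)
    ; σ = λ m → combine m (B p p p)
    ; r-inj = combine-injectiveˡ′ ; c-inj = combine-injectiveˡ′
    ; s-inj = combine-injectiveˡ′ ; σ-inj = combine-injectiveˡ′
    ; M = A ; M-latin = A-latin
    ; entries = λ i j k → ⊗-combine A B i j k p p p
    }

  fibreSubcubes-disjoint : {A : Cube a} (B : Cube n) (A-latin : IsLatin A) →
    Injective _≡_ _≡_ (λ p → B p p p) →
    ∀ p q → p ≢ q → Disjoint (fibreSubcube B A-latin p) (fibreSubcube B A-latin q)
  fibreSubcubes-disjoint B A-latin diagonal-inj p q p≢q =
      (λ i j eq → p≢q (combine-injectiveʳ′ eq))
    , (λ i j eq → p≢q (combine-injectiveʳ′ eq))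
    , (λ i j eq → p≢q (combine-injectiveʳ′ eq))
    , (λ i j eq → p≢q (diagonal-inj (combine-injectiveʳ′ eq)))

theorem11 : (a n : ℕ) → a ≥ 1 → n ≥ 1 → LC a n
theorem11 a n a≥1 n≥1 =
    A ⊗ B
  , ⊗-latin A-latin B-latin
  , fibreSubcube B A-latin
  , fibreSubcubes-disjoint B A-latin cyclicCube-diagonal-injective
  where
  open Cyclic
  open Product
  instance
    a≢0 : NonZero a
    a≢0 = >-nonZero a≥1
    n≢0 : NonZero n
    n≢0 = >-nonZero n≥1
  A : Cube a
  A = cyclicCube
  A-latin : IsLatin A
  A-latin = cyclicCube-latin
  B : Cube n
  B = cyclicCube
  B-latin : IsLatin B
  B-latin = cyclicCube-latin
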